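{- Let $k>0$ be a constant. Any deterministic single-pass streaming algorithm that determines the highest support of a $k$-itemset in a transaction data stream over $n$ distinct items must, after having processed transactions of total size $mb$, use space $\Omega(\min(mb,\,n^k))$ bits on a worst-case input.
   Context: A transaction is a subset of the item set $\{1,\dots,n\}$; the stream is a sequence of transactions read one at a time in one pass, and $mb$ denotes the total number of item occurrences in the transactions processed so far. A $k$-itemset is a set of $k$ items, and its support is the number of transactions containing it as a subset. Space is the number of bits of memory the algorithm maintains. -}

module Defs where

open import Data.Bool using (Bool)
open import Data.Nat using (ℕ; zero; suc; _⊔_; _≟_)
open import Data.List using (List; []; _∷_; map; foldl; foldr; filter; length; _++_)
open import Data.Nat.ListAction using (sum)
open import Data.Vec using (_∷_; [])
open import Data.Fin.Subset using (Subset; ∣_∣; inside; outside)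
open import Data.Fin.Subset.Properties using (_⊆?_)

Transaction : ℕ → Set
Transaction n = Subset n

TStream : ℕ → Set
TStream n = List (Transaction n)

totalSize : ∀ {n} → TStream n → ℕ
totalSize s = sum (map ∣_∣ s)

support : ∀ {n} → Subset n → TStream n → ℕ
support I s = length (filter (I ⊆?_) s)

allSubsets : (n : ℕ) → List (Subset n)
allSubsets zero = [] ∷ []
allSubsets (suc n) = map (outside ∷_) (allSubsets n) ++ map (inside ∷_) (allSubsets n)

kItemsets : (n k : ℕ) → List (Subset n)
kItemsets n k = filter (λ I → ∣ I ∣ ≟ k) (allSubsets n)

-- highest support of a k-itemset in the stream (0 if there are no k-itemsets)
highestSupport : ∀ {n} → ℕ → TStream n → ℕ
highestSupport {n} k s = foldr _⊔_ 0 (map (λ I → support I s) (kItemsets n k))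

-- Computation power is unrestricted; only the memory is measured.
record StreamAlg (n : ℕ) : Set where
  field
    init   : List Bool
    step   : List Bool → Transaction n → List Bool
    answer : List Bool → ℕ

open StreamAlg public

run : ∀ {n} → StreamAlg n → TStream n → List Bool
run A s = foldl (step A) (init A) s

space : ∀ {n} → StreamAlg n → TStream n → ℕ
space A s = length (run A s)

-- the algorithm determines the highest k-itemset support after every
-- prefix of every stream (every finite stream is a prefix of some stream)
Determines : ∀ {n} → ℕ → StreamAlg n → Set
Determines k A = ∀ s → answer A (run A s) ≡ highestSupport k s
  where open import Relation.Binary.PropositionalEquality using (_≡_)

-- The proof is a fooling-set argument.  For n = n' + 1 items with k ≤ n', item 0
-- is reserved for padding and the remaining n' items carry X = #kItemsets n' k
-- distinct k-itemsets, where (n' + 1)^k ≤ (2k)^k · X by a binomial estimate.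
-- Group 2m of these itemsets into m consecutive pairs.  A bit vector
-- b ∈ {0,1}^m selects one itemset of each pair; the stream {0}^R · (selection)
-- has total size R + mk, adjusted to mb by R.  If two different bit vectors
-- left the algorithm with the same memory, an itemset T selected by only one of
-- them, appended often enough, would make the highest supports of the two
-- extended streams differ, yet the algorithm gives both the same answer.  So
-- the 2^m memory contents are distinct bit strings and one has at least m bits.
-- Taking m = ⌊min(mb, X) / 2k⌋ yields the corollary.
module Submission where

open import Defs
open import Data.Bool using (Bool; true; false; if_then_else_)
import Data.Bool
open import Data.Nat using (ℕ; zero; suc; _+_; _*_; _^_; _∸_; _≤_; _<_; _⊔_; _⊓_; _≟_; _≤?_; _<?_; z≤n; s≤s; s≤s⁻¹; NonZero; >-nonZero; _/_; _%_)
open import Data.Nat.Properties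
open import Data.Nat.DivMod using (m≡m%n+[m/n]*n; m%n<n; m/n*n≤m; m≥n⇒m/n>0)
open import Data.Nat.Binary using (ℕᵇ; zero; 2[1+_]; 1+[2_])
import Data.Nat.Binary as ℕᵇ
open import Data.Nat.Binary.Properties using (toℕ-injective; 2[1+_]-injective; 1+[2_]-injective)
open import Data.Nat.Tactic.RingSolver using (solve-∀)
open import Data.List using (List; []; _∷_; map; foldl; foldr; filter; length; _++_; replicate)
open import Data.List.Properties using (length-++; length-map; length-filter; length-replicate; filter-++; filter-all; filter-none; filter-some; foldl-++)
open import Data.List.Membership.Propositional using (_∈_; _∉_)
open import Data.List.Membership.Propositional.Properties using (∈-map⁺; ∈-map⁻; ∈-++⁺ˡ; ∈-++⁺ʳ; ∈-filter⁺; ∈-filter⁻)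
open import Data.List.Relation.Unary.All using (All; []; _∷_)
import Data.List.Relation.Unary.All as All
open import Data.List.Relation.Unary.All.Properties using (replicate⁺; ++⁺)
open import Data.List.Relation.Unary.Any using (here; there)
import Data.List.Relation.Unary.Any as Any
open import Data.List.Relation.Unary.Unique.Propositional using (Unique; []; _∷_)
import Data.List.Relation.Unary.Unique.Propositional.Properties as Unique
open import Data.Vec using (Vec; _∷_; [])
open import Data.Vec.Properties using (≡-dec; ∷-injectiveʳ)
open import Data.Vec.Recursive using (Fin[m^n]↔Fin[m]^n; lift↔)
open import Data.Vec.Recursive.Properties using (↔Vec)
open import Data.Fin using (Fin; toℕ; fromℕ<)
open import Data.Fin.Properties using (2↔Bool; any?; injective⇒≤; toℕ-fromℕ<)
open import Data.Fin.Subset using (Subset; ∣_∣; inside; outside; _⊆_; ⊥)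
open import Data.Fin.Subset.Properties using (_⊆?_; ⊆-refl; ⊆-reflexive; drop-∷-⊆; p⊆q⇒∣p∣≤∣q∣; ∣⊥∣≡0)
open import Data.Product using (∃-syntax; _×_; _,_; proj₂; map₂)
open import Function.Bundles using (_↔_; Inverse)
open import Function.Properties.Inverse using (↔-trans)
open import Relation.Nullary using (¬_; yes; no; contradiction; does)
open import Relation.Binary.PropositionalEquality

⊆-∣≡∣⇒≡ : ∀ {n} {p q : Subset n} → p ⊆ q → ∣ p ∣ ≡ ∣ q ∣ → p ≡ q
⊆-∣≡∣⇒≡ {p = []}          {[]}          _   _ = refl
⊆-∣≡∣⇒≡ {p = outside ∷ p} {outside ∷ q} p⊆q e = cong (outside ∷_) (⊆-∣≡∣⇒≡ (drop-∷-⊆ p⊆q) e)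
⊆-∣≡∣⇒≡ {p = outside ∷ p} {inside ∷ q}  p⊆q e =
  contradiction e (<⇒≢ (s≤s (p⊆q⇒∣p∣≤∣q∣ (drop-∷-⊆ p⊆q))))
⊆-∣≡∣⇒≡ {p = inside ∷ p}  {outside ∷ q} p⊆q _ = contradiction (p⊆q Data.Vec.here) λ ()
⊆-∣≡∣⇒≡ {p = inside ∷ p}  {inside ∷ q}  p⊆q e =
  cong (inside ∷_) (⊆-∣≡∣⇒≡ (drop-∷-⊆ p⊆q) (suc-injective e))

support-++ : ∀ {n} (I : Subset n) (s t : TStream n) → support I (s ++ t) ≡ support I s + support I t
support-++ I s t = trans (cong length (filter-++ (I ⊆?_) s t)) (length-++ (filter (I ⊆?_) s))

support-all : ∀ {n} (I : Subset n) {s : TStream n} → All (I ⊆_) s → support I s ≡ length s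
support-all I all = cong length (filter-all (I ⊆?_) all)

support-none : ∀ {n} (I : Subset n) {s : TStream n} → All (λ J → ¬ I ⊆ J) s → support I s ≡ 0
support-none I none = cong length (filter-none (I ⊆?_) none)

maxOf : ∀ {A : Set} → (A → ℕ) → List A → ℕ
maxOf f xs = foldr _⊔_ 0 (map f xs)

maxOf-upper : ∀ {A : Set} (f : A → ℕ) {xs x} → x ∈ xs → f x ≤ maxOf f xs
maxOf-upper f {y ∷ xs} (here refl) = m≤m⊔n (f y) _
maxOf-upper f {y ∷ xs} (there x∈xs) = ≤-trans (maxOf-upper f x∈xs) (m≤n⊔m (f y) _)

maxOf-lub : ∀ {A : Set} (f : A → ℕ) xs {b} → (∀ {x} → x ∈ xs → f x ≤ b) → maxOf f xs ≤ b
maxOf-lub f []       bound = z≤n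
maxOf-lub f (y ∷ xs) bound = ⊔-lub (bound (here refl)) (maxOf-lub f xs (λ x∈xs → bound (there x∈xs)))

allSubsets-complete : ∀ n (p : Subset n) → p ∈ allSubsets n
allSubsets-complete zero    []            = here refl
allSubsets-complete (suc n) (outside ∷ p) = ∈-++⁺ˡ (∈-map⁺ (outside ∷_) (allSubsets-complete n p))
allSubsets-complete (suc n) (inside ∷ p)  =
  ∈-++⁺ʳ (map (outside ∷_) (allSubsets n)) (∈-map⁺ (inside ∷_) (allSubsets-complete n p))

allSubsets-unique : ∀ n → Unique (allSubsets n)
allSubsets-unique zero    = [] ∷ []
allSubsets-unique (suc n) =
  Unique.++⁺ (Unique.map⁺ ∷-injectiveʳ (allSubsets-unique n)) (Unique.map⁺ ∷-injectiveʳ (allSubsets-unique n)) disjoint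
  where
  disjoint : ∀ {v} → ¬ (v ∈ map (outside ∷_) (allSubsets n) × v ∈ map (inside ∷_) (allSubsets n))
  disjoint (v∈outs , v∈ins) with ∈-map⁻ (outside ∷_) v∈outs | ∈-map⁻ (inside ∷_) v∈ins
  ... | _ , _ , refl | _ , _ , ()

kItemsets-card : ∀ {n k} {I : Subset n} → I ∈ kItemsets n k → ∣ I ∣ ≡ k
kItemsets-card {n} {k} I∈ = proj₂ (∈-filter⁻ (λ I → ∣ I ∣ ≟ k) {xs = allSubsets n} I∈)

kItemsets-unique : ∀ n k → Unique (kItemsets n k)
kItemsets-unique n k = Unique.filter⁺ (λ I → ∣ I ∣ ≟ k) (allSubsets-unique n)

highestSupport-upper : ∀ {n} k (s : TStream n) {I} → ∣ I ∣ ≡ k → support I s ≤ highestSupport k s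
highestSupport-upper {n} k s {I} ∣I∣≡k =
  maxOf-upper (λ I → support I s) (∈-filter⁺ (λ I → ∣ I ∣ ≟ k) (allSubsets-complete n I) ∣I∣≡k)

highestSupport-lub : ∀ {n} k (s : TStream n) {b} → (∀ {I} → ∣ I ∣ ≡ k → support I s ≤ b) → highestSupport k s ≤ b
highestSupport-lub {n} k s bound =
  maxOf-lub (λ I → support I s) (kItemsets n k) (λ I∈ → bound (kItemsets-card I∈))

#kItemsets : ℕ → ℕ → ℕ
#kItemsets n k = length (kItemsets n k)

countCard : ∀ {n} → ℕ → List (Subset n) → ℕ
countCard j xs = length (filter (λ I → ∣ I ∣ ≟ j) xs)

countCard-outside : ∀ {n} j (xs : List (Subset n)) → countCard j (map (outside ∷_) xs) ≡ countCard j xs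
countCard-outside j []       = refl
countCard-outside j (x ∷ xs) with does (∣ x ∣ ≟ j)
... | true  = cong suc (countCard-outside j xs)
... | false = countCard-outside j xs

countCard-inside : ∀ {n} j (xs : List (Subset n)) → countCard (suc j) (map (inside ∷_) xs) ≡ countCard j xs
countCard-inside j []       = refl
countCard-inside j (x ∷ xs) with does (∣ x ∣ ≟ j)
... | true  = cong suc (countCard-inside j xs)
... | false = countCard-inside j xs

countCard-inside-zero : ∀ {n} (xs : List (Subset n)) → countCard 0 (map (inside ∷_) xs) ≡ 0
countCard-inside-zero []       = refl
countCard-inside-zero (x ∷ xs) = countCard-inside-zero xs

#kItemsets-split : ∀ n k → #kItemsets (suc n) k ≡
  countCard k (map (outside ∷_) (allSubsets n)) + countCard k (map (inside ∷_) (allSubsets n))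
#kItemsets-split n k = trans (cong length (filter-++ card≟k outs ins)) (length-++ (filter card≟k outs))
  where
  card≟k = λ (I : Subset (suc n)) → ∣ I ∣ ≟ k
  outs = map (outside ∷_) (allSubsets n)
  ins  = map (inside ∷_) (allSubsets n)

#kItemsets-zero : ∀ n → #kItemsets n 0 ≡ 1
#kItemsets-zero zero    = refl
#kItemsets-zero (suc n) = begin
  #kItemsets (suc n) 0                        ≡⟨ #kItemsets-split n 0 ⟩
  countCard 0 (map (outside ∷_) (allSubsets n))
    + countCard 0 (map (inside ∷_) (allSubsets n)) ≡⟨ cong₂ _+_ (countCard-outside 0 (allSubsets n)) (countCard-inside-zero (allSubsets n)) ⟩
  #kItemsets n 0 + 0                          ≡⟨ +-identityʳ _ ⟩
  #kItemsets n 0                              ≡⟨ #kItemsets-zero n ⟩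
  1                                           ∎
  where open ≡-Reasoning

#kItemsets-pascal : ∀ n k → #kItemsets (suc n) (suc k) ≡ #kItemsets n (suc k) + #kItemsets n k
#kItemsets-pascal n k = trans (#kItemsets-split n (suc k))
  (cong₂ _+_ (countCard-outside (suc k) (allSubsets n)) (countCard-inside k (allSubsets n)))

#kItemsets-mono-suc : ∀ n k → #kItemsets n k ≤ #kItemsets (suc n) k
#kItemsets-mono-suc n zero    = ≤-reflexive (trans (#kItemsets-zero n) (sym (#kItemsets-zero (suc n))))
#kItemsets-mono-suc n (suc k) = ≤-trans (m≤m+n _ _) (≤-reflexive (sym (#kItemsets-pascal n k)))

#kItemsets-mono : ∀ t n k → #kItemsets n k ≤ #kItemsets (t + n) k
#kItemsets-mono zero    n k = ≤-refl
#kItemsets-mono (suc t) n k = ≤-trans (#kItemsets-mono t n k) (#kItemsets-mono-suc (t + n) k)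

#kItemsets-step : ∀ t N k → t * #kItemsets N k ≤ #kItemsets (t + N) (suc k)
#kItemsets-step zero    N k = z≤n
#kItemsets-step (suc t) N k = begin
  #kItemsets N k + t * #kItemsets N k                 ≤⟨ +-mono-≤ (#kItemsets-mono t N k) (#kItemsets-step t N k) ⟩
  #kItemsets (t + N) k + #kItemsets (t + N) (suc k)   ≡⟨ +-comm (#kItemsets (t + N) k) _ ⟩
  #kItemsets (t + N) (suc k) + #kItemsets (t + N) k   ≡⟨ #kItemsets-pascal (t + N) k ⟨
  #kItemsets (suc t + N) (suc k)                      ∎
  where open ≤-Reasoning

-- q^k ≤ (kq choose k): choose one item from each of k blocks of size q.
#kItemsets-power : ∀ q k → q ^ k ≤ #kItemsets (k * q) k
#kItemsets-power q zero    = ≤-reflexive (sym (#kItemsets-zero 0))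
#kItemsets-power q (suc k) = ≤-trans (*-monoʳ-≤ q (#kItemsets-power q k)) (#kItemsets-step q (k * q) k)

*-distribʳ-^ : ∀ a b k → (a * b) ^ k ≡ a ^ k * b ^ k
*-distribʳ-^ a b zero    = refl
*-distribʳ-^ a b (suc k) = trans (cong ((a * b) *_) (*-distribʳ-^ a b k)) (interchange a b (a ^ k) (b ^ k))
  where
  interchange : ∀ a b x y → (a * b) * (x * y) ≡ (a * x) * (b * y)
  interchange = solve-∀

-- Many k-itemsets: with q = ⌊n'/k⌋ ≥ 1 we have n' + 1 ≤ 2kq and
-- q^k ≤ #kItemsets n' k, hence (n' + 1)^k ≤ (2k)^k · #kItemsets n' k.
#kItemsets-large : ∀ k n' .{{_ : NonZero k}} → k ≤ n' → suc n' ^ k ≤ (2 * k) ^ k * #kItemsets n' k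
#kItemsets-large k n' k≤n' = begin
  suc n' ^ k                              ≤⟨ ^-monoˡ-≤ k n'<2kq ⟩
  (2 * k * q) ^ k                         ≡⟨ *-distribʳ-^ (2 * k) q k ⟩
  (2 * k) ^ k * q ^ k                     ≤⟨ *-monoʳ-≤ ((2 * k) ^ k) (#kItemsets-power q k) ⟩
  (2 * k) ^ k * #kItemsets (k * q) k      ≤⟨ *-monoʳ-≤ ((2 * k) ^ k) (#kItemsets-mono r (k * q) k) ⟩
  (2 * k) ^ k * #kItemsets (r + k * q) k  ≡⟨ cong (λ z → (2 * k) ^ k * #kItemsets z k) n'≡r+kq ⟨
  (2 * k) ^ k * #kItemsets n' k           ∎
  where
  open ≤-Reasoning
  q = n' / k
  r = n' % k
  n'≡r+kq : n' ≡ r + k * q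
  n'≡r+kq = trans (m≡m%n+[m/n]*n n' k) (cong (r +_) (*-comm q k))
  double : ∀ k q → k * q + k * q ≡ 2 * k * q
  double = solve-∀
  n'<2kq : suc n' ≤ 2 * k * q
  n'<2kq = begin
    suc n'            ≡⟨ cong suc n'≡r+kq ⟩
    suc r + k * q     ≤⟨ +-monoˡ-≤ (k * q) (m%n<n n' k) ⟩
    k + k * q         ≤⟨ +-monoˡ-≤ (k * q) (m≤m*n k q {{>-nonZero (m≥n⇒m/n>0 k≤n')}}) ⟩
    k * q + k * q     ≡⟨ double k q ⟩
    2 * k * q         ∎

module _ {S : Set} where

  #pairs : List S → ℕ
  #pairs []           = 0
  #pairs (_ ∷ [])     = 0
  #pairs (_ ∷ _ ∷ xs) = suc (#pairs xs)

  #pairs-≥ : ∀ {m} (xs : List S) → m + m ≤ length xs → m ≤ #pairs xs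
  #pairs-≥ {zero}  xs           _       = z≤n
  #pairs-≥ {suc m} (_ ∷ [])     (s≤s h) = contradiction (subst (_≤ 0) (+-suc m m) h) λ ()
  #pairs-≥ {suc m} (_ ∷ _ ∷ xs) (s≤s h) =
    s≤s (#pairs-≥ xs (s≤s⁻¹ (subst (_≤ suc (length xs)) (+-suc m m) h)))

  select : ∀ {m} → List S → Vec Bool m → List S
  select (u ∷ v ∷ xs) (b ∷ bs) = (if b then u else v) ∷ select xs bs
  select (_ ∷ _ ∷ _)  []       = []
  select (_ ∷ [])     _        = []
  select []           _        = []

  select-⊆ : ∀ {m} (xs : List S) (bs : Vec Bool m) {T} → T ∈ select xs bs → T ∈ xs
  select-⊆ (u ∷ v ∷ xs) (true  ∷ bs) (here refl) = here refl
  select-⊆ (u ∷ v ∷ xs) (false ∷ bs) (here refl) = there (here refl)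
  select-⊆ (u ∷ v ∷ xs) (b ∷ bs)     (there T∈)  = there (there (select-⊆ xs bs T∈))

  select-length : ∀ {m} (xs : List S) (bs : Vec Bool m) → m ≤ #pairs xs → length (select xs bs) ≡ m
  select-length (_ ∷ _ ∷ _)  []       _        = refl
  select-length (_ ∷ [])     []       _        = refl
  select-length []           []       _        = refl
  select-length (u ∷ v ∷ xs) (b ∷ bs) (s≤s m≤) = cong suc (select-length xs bs m≤)

  first-pair-fresh : ∀ {u v : S} {xs : List S} → Unique (u ∷ v ∷ xs) → u ∉ v ∷ xs × v ∉ xs × Unique xs
  first-pair-fresh uniq@(_ ∷ uniq'@(_ ∷ uniq'')) =
    Unique.Unique[x∷xs]⇒x∉xs uniq , Unique.Unique[x∷xs]⇒x∉xs uniq' , uniq''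

  separates-∷ : ∀ {w T : S} {xs ys zs : List S} → w ∉ xs → (∀ {x} → x ∈ ys → x ∈ xs) →
    T ∈ ys × T ∉ zs → T ∈ w ∷ ys × T ∉ w ∷ zs
  separates-∷ w∉xs ys⊆xs (T∈ys , T∉zs) = there T∈ys , λ { (here refl) → w∉xs (ys⊆xs T∈ys) ; (there T∈zs) → T∉zs T∈zs }

  select-separates : ∀ {m} (xs : List S) → Unique xs → m ≤ #pairs xs → (bs bs' : Vec Bool m) → bs ≢ bs' →
    ∃[ T ] (T ∈ select xs bs × T ∉ select xs bs')
  select-separates xs _ _ [] [] bs≢bs' = contradiction refl bs≢bs'
  select-separates (u ∷ v ∷ xs) uniq (s≤s m≤) (true ∷ bs) (false ∷ bs') _ =
    let u∉v∷xs , _ , _ = first-pair-fresh uniq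
    in  u , here refl , λ { (here u≡v) → u∉v∷xs (here u≡v) ; (there u∈) → u∉v∷xs (there (select-⊆ xs bs' u∈)) }
  select-separates (u ∷ v ∷ xs) uniq (s≤s m≤) (false ∷ bs) (true ∷ bs') _ =
    let u∉v∷xs , v∉xs , _ = first-pair-fresh uniq
    in  v , here refl , λ { (here v≡u) → u∉v∷xs (here (sym v≡u)) ; (there v∈) → v∉xs (select-⊆ xs bs' v∈) }
  select-separates (u ∷ v ∷ xs) uniq (s≤s m≤) (true ∷ bs) (true ∷ bs') bs≢bs' =
    let u∉v∷xs , _ , uniq' = first-pair-fresh uniq
    in  map₂ (separates-∷ (λ u∈xs → u∉v∷xs (there u∈xs)) (select-⊆ xs bs))
          (select-separates xs uniq' m≤ bs bs' (λ bs≡bs' → bs≢bs' (cong (true ∷_) bs≡bs')))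
  select-separates (u ∷ v ∷ xs) uniq (s≤s m≤) (false ∷ bs) (false ∷ bs') bs≢bs' =
    let _ , v∉xs , uniq' = first-pair-fresh uniq
    in  map₂ (separates-∷ v∉xs (select-⊆ xs bs))
          (select-separates xs uniq' m≤ bs bs' (λ bs≡bs' → bs≢bs' (cong (false ∷_) bs≡bs')))

-- Bit lists written as bijective base-2 numerals (digits 1 and 2).
toℕᵇ : List Bool → ℕᵇ
toℕᵇ []          = zero
toℕᵇ (false ∷ l) = 1+[2 toℕᵇ l ]
toℕᵇ (true ∷ l)  = 2[1+ toℕᵇ l ]

toℕᵇ-injective : ∀ {l l'} → toℕᵇ l ≡ toℕᵇ l' → l ≡ l'
toℕᵇ-injective {[]}        {[]}         _    = refl
toℕᵇ-injective {false ∷ l} {false ∷ l'} eq   = cong (false ∷_) (toℕᵇ-injective (1+[2_]-injective eq))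
toℕᵇ-injective {true ∷ l}  {true ∷ l'}  eq   = cong (true ∷_) (toℕᵇ-injective (2[1+_]-injective eq))
toℕᵇ-injective {[]}        {false ∷ _}  ()
toℕᵇ-injective {[]}        {true ∷ _}   ()
toℕᵇ-injective {false ∷ _} {[]}         ()
toℕᵇ-injective {false ∷ _} {true ∷ _}   ()
toℕᵇ-injective {true ∷ _}  {[]}         ()
toℕᵇ-injective {true ∷ _}  {false ∷ _}  ()

value : List Bool → ℕ
value l = ℕᵇ.toℕ (toℕᵇ l)

value-injective : ∀ {l l'} → value l ≡ value l' → l ≡ l'
value-injective eq = toℕᵇ-injective (toℕ-injective eq)

value-bound : ∀ l → value l + 2 ≤ 2 ^ suc (length l)
value-bound []      = ≤-refl
value-bound (b ∷ l) = ≤-trans (digit-step b) (*-monoʳ-≤ 2 (value-bound l))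
  where
  odd-digit : ∀ e → suc (suc (2 * e) + 2) ≡ 2 * (e + 2)
  odd-digit = solve-∀
  even-digit : ∀ e → 2 * suc e + 2 ≡ 2 * (e + 2)
  even-digit = solve-∀
  digit-step : ∀ b → value (b ∷ l) + 2 ≤ 2 * (value l + 2)
  digit-step false = ≤-trans (n≤1+n _) (≤-reflexive (odd-digit (value l)))
  digit-step true  = ≤-reflexive (even-digit (value l))

enumeration : ∀ m → Fin (2 ^ m) ↔ Vec Bool m
enumeration m = ↔-trans (Fin[m^n]↔Fin[m]^n 2 m) (↔-trans (lift↔ m 2↔Bool) (↔Vec m))

bitVector : ∀ m → Fin (2 ^ m) → Vec Bool m
bitVector m = Inverse.to (enumeration m)

bitVector-injective : ∀ m {i j} → bitVector m i ≡ bitVector m j → i ≡ j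
bitVector-injective m {i} {j} eq = begin
  i                       ≡⟨ strictlyInverseʳ i ⟨
  from (bitVector m i)    ≡⟨ cong from eq ⟩
  from (bitVector m j)    ≡⟨ strictlyInverseʳ j ⟩
  j                       ∎
  where
  open ≡-Reasoning
  open Inverse (enumeration m)

-- Pigeonhole: an injective map from m-bit vectors to bit lists has an output of
-- length at least m, since the 2^m − 1 lists of length < m are too few.
long-output : ∀ m (f : Vec Bool m → List Bool) → (∀ {b b'} → f b ≡ f b' → b ≡ b') → ∃[ b ] m ≤ length (f b)
long-output m f f-injective with any? (λ i → m ≤? length (f (bitVector m i)))
... | yes (i , long) = bitVector m i , long
... | no no-long = contradiction (injective⇒≤ code-injective) (<⇒≱ (∸-monoʳ-< (s≤s z≤n) (m^n>0 2 m)))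
  where
  output : Fin (2 ^ m) → List Bool
  output i = f (bitVector m i)
  value<2^m∸1 : ∀ i → value (output i) < 2 ^ m ∸ 1
  value<2^m∸1 i = m+n≤o⇒m≤o∸n (suc (value (output i))) (begin
    suc (value (output i)) + 1  ≡⟨ +-suc (value (output i)) 1 ⟨
    value (output i) + 2        ≤⟨ value-bound (output i) ⟩
    2 ^ suc (length (output i)) ≤⟨ ^-monoʳ-≤ 2 (≰⇒> (λ long → no-long (i , long))) ⟩
    2 ^ m                       ∎)
    where open ≤-Reasoning
  code : Fin (2 ^ m) → Fin (2 ^ m ∸ 1)
  code i = fromℕ< (value<2^m∸1 i)
  code-injective : ∀ {i j} → code i ≡ code j → i ≡ j
  code-injective {i} {j} eq = bitVector-injective m (f-injective (value-injective values-equal))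
    where
    values-equal : value (output i) ≡ value (output j)
    values-equal = trans (sym (toℕ-fromℕ< (value<2^m∸1 i))) (trans (cong toℕ eq) (toℕ-fromℕ< (value<2^m∸1 j)))

totalSize-++ : ∀ {n} (s t : TStream n) → totalSize (s ++ t) ≡ totalSize s + totalSize t
totalSize-++ []      t = refl
totalSize-++ (T ∷ s) t = trans (cong (∣ T ∣ +_) (totalSize-++ s t)) (sym (+-assoc ∣ T ∣ _ _))

totalSize-uniform : ∀ {n} j {s : TStream n} → All (λ T → ∣ T ∣ ≡ j) s → totalSize s ≡ length s * j
totalSize-uniform j []           = refl
totalSize-uniform j (∣T∣≡j ∷ all) = cong₂ _+_ ∣T∣≡j (totalSize-uniform j all)

-- An algorithm cannot tell apart two streams after which its memory is the
-- same: every continuation then gets the same answer, so the same highest support.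
same-memory⇒same-highestSupport : ∀ {n k} (A : StreamAlg n) → Determines k A → ∀ {s s' : TStream n} →
  run A s ≡ run A s' → ∀ t → highestSupport k (s ++ t) ≡ highestSupport k (s' ++ t)
same-memory⇒same-highestSupport A determines {s} {s'} same t = begin
  highestSupport _ (s ++ t)               ≡⟨ determines (s ++ t) ⟨
  answer A (run A (s ++ t))               ≡⟨ cong (answer A) (foldl-++ (step A) (init A) s t) ⟩
  answer A (foldl (step A) (run A s) t)   ≡⟨ cong (λ mem → answer A (foldl (step A) mem t)) same ⟩
  answer A (foldl (step A) (run A s') t)  ≡⟨ cong (answer A) (foldl-++ (step A) (init A) s' t) ⟨
  answer A (run A (s' ++ t))              ≡⟨ determines (s' ++ t) ⟩
  highestSupport _ (s' ++ t)              ∎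
  where open ≡-Reasoning

-- A k-itemset T contained in some transaction of s but in none of s' separates
-- the streams: appending length s' copies of T, the highest support exceeds
-- length s' after s but is at most length s' after s'.
separated-highestSupport : ∀ {n} k (T : Subset n) → ∣ T ∣ ≡ k → (s s' : TStream n) →
  0 < support T s → support T s' ≡ 0 →
  highestSupport k (s' ++ replicate (length s') T) < highestSupport k (s ++ replicate (length s') T)
separated-highestSupport k T ∣T∣≡k s s' T-in-s T-not-in-s' = begin-strict
  highestSupport k (s' ++ copies)    ≤⟨ highestSupport-lub k (s' ++ copies) support≤ ⟩
  length s'                          <⟨ +-monoˡ-≤ (length s') T-in-s ⟩
  support T s + length s'            ≡⟨ cong (support T s +_) T-in-copies ⟨
  support T s + support T copies     ≡⟨ support-++ T s copies ⟨
  support T (s ++ copies)            ≤⟨ highestSupport-upper k (s ++ copies) ∣T∣≡k ⟩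
  highestSupport k (s ++ copies)     ∎
  where
  open ≤-Reasoning
  copies = replicate (length s') T
  T-in-copies : support T copies ≡ length s'
  T-in-copies = trans (support-all T (replicate⁺ (length s') ⊆-refl)) (length-replicate (length s'))
  -- after s', a k-itemset other than T gets nothing from the copies,
  -- and T itself gets nothing from s'
  support≤ : ∀ {I} → ∣ I ∣ ≡ k → support I (s' ++ copies) ≤ length s'
  support≤ {I} ∣I∣≡k with I ⊆? T
  ... | yes I⊆T with ⊆-∣≡∣⇒≡ I⊆T (trans ∣I∣≡k (sym ∣T∣≡k))
  ...   | refl = ≤-reflexive (begin-equality
    support T (s' ++ copies)           ≡⟨ support-++ T s' copies ⟩
    support T s' + support T copies    ≡⟨ cong₂ _+_ T-not-in-s' T-in-copies ⟩
    length s'                          ∎)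
  support≤ {I} ∣I∣≡k | no I⊈T = begin
    support I (s' ++ copies)           ≡⟨ support-++ I s' copies ⟩
    support I s' + support I copies    ≡⟨ cong (support I s' +_) (support-none I (replicate⁺ (length s') I⊈T)) ⟩
    support I s' + 0                   ≡⟨ +-identityʳ _ ⟩
    support I s'                       ≤⟨ length-filter (I ⊆?_) s' ⟩
    length s'                          ∎

-- Let P be a one-item transaction and xs a list
-- of distinct k-itemsets none of which is contained in P.  The streams
-- P^R · select xs b, for b ∈ {0,1}^m, all have total size mb and pairwise
-- distinct memory contents, so one of them needs at least m bits.
fooling-bound : ∀ {n k m} (A : StreamAlg n) → Determines k A → (P : Subset n) → ∣ P ∣ ≡ 1 →
  (xs : List (Subset n)) → Unique xs → (∀ {T} → T ∈ xs → ∣ T ∣ ≡ k) → (∀ {T} → T ∈ xs → ¬ T ⊆ P) →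
  m ≤ #pairs xs → ∀ mb → m * k ≤ mb → ∃[ s ] (totalSize s ≡ mb × m ≤ space A s)
fooling-bound {n} {k} {m} A determines P ∣P∣≡1 xs uniq k-sets not⊆P m≤ mb mk≤mb =
  let bs , m≤space = long-output m (λ bs → run A (stream bs)) memory-injective
  in  stream bs , size bs , m≤space
  where
  padding = mb ∸ m * k
  stream : Vec Bool m → TStream n
  stream bs = replicate padding P ++ select xs bs

  size : ∀ bs → totalSize (stream bs) ≡ mb
  size bs = begin
    totalSize (stream bs)                                          ≡⟨ totalSize-++ (replicate padding P) (select xs bs) ⟩
    totalSize (replicate padding P) + totalSize (select xs bs)     ≡⟨ cong₂ _+_
      (totalSize-uniform 1 (replicate⁺ padding ∣P∣≡1))
      (totalSize-uniform k (All.tabulate (λ T∈ → k-sets (select-⊆ xs bs T∈)))) ⟩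
    length (replicate padding P) * 1 + length (select xs bs) * k  ≡⟨ cong₂ (λ a b → a * 1 + b * k) (length-replicate padding) (select-length xs bs m≤) ⟩
    padding * 1 + m * k                                            ≡⟨ cong (_+ m * k) (*-identityʳ padding) ⟩
    padding + m * k                                                ≡⟨ m∸n+n≡m mk≤mb ⟩
    mb                                                             ∎
    where open ≡-Reasoning

  selected-present : ∀ bs {T} → T ∈ select xs bs → 0 < support T (stream bs)
  selected-present bs T∈ = filter-some (_ ⊆?_) (Any.map ⊆-reflexive (∈-++⁺ʳ (replicate padding P) T∈))

  -- while an itemset of xs not selected by bs' lies in no transaction of stream bs',
  -- since the selected itemsets have its size and the padding P avoids it
  unselected-absent : ∀ bs' {T} → T ∈ xs → T ∉ select xs bs' → support T (stream bs') ≡ 0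
  unselected-absent bs' {T} T∈xs T∉ = support-none T (++⁺ (replicate⁺ padding (not⊆P T∈xs)) (All.tabulate not-superset))
    where
    not-superset : ∀ {J} → J ∈ select xs bs' → ¬ T ⊆ J
    not-superset J∈ T⊆J = T∉ (subst (_∈ select xs bs') (sym (⊆-∣≡∣⇒≡ T⊆J same-size)) J∈)
      where same-size = trans (k-sets T∈xs) (sym (k-sets (select-⊆ xs bs' J∈)))

  -- so the element selected by bs but not by bs' separates the two streams
  memory-differs : ∀ bs bs' → bs ≢ bs' → run A (stream bs) ≢ run A (stream bs')
  memory-differs bs bs' bs≢bs' same =
    let T , T∈ , T∉ = select-separates xs uniq m≤ bs bs' bs≢bs'
        T∈xs = select-⊆ xs bs T∈
    in  <-irrefl (sym (same-memory⇒same-highestSupport A determines {stream bs} {stream bs'} same _))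
          (separated-highestSupport k T (k-sets T∈xs) (stream bs) (stream bs')
            (selected-present bs T∈) (unselected-absent bs' T∈xs T∉))

  memory-injective : ∀ {bs bs'} → run A (stream bs) ≡ run A (stream bs') → bs ≡ bs'
  memory-injective {bs} {bs'} same with ≡-dec Data.Bool._≟_ bs bs'
  ... | yes bs≡bs' = bs≡bs'
  ... | no  bs≢bs' = contradiction same (memory-differs bs bs' bs≢bs')

≤-double-quotient : ∀ x d .{{_ : NonZero d}} → d ≤ x → x ≤ d * 2 * (x / d)
≤-double-quotient x d d≤x = begin
  x                         ≡⟨ m≡m%n+[m/n]*n x d ⟩
  x % d + x / d * d         ≤⟨ +-monoˡ-≤ (x / d * d) (<⇒≤ (m%n<n x d)) ⟩
  d + x / d * d             ≡⟨ cong (_+ x / d * d) (*-identityˡ d) ⟨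
  1 * d + x / d * d         ≤⟨ +-monoˡ-≤ (x / d * d) (*-monoˡ-≤ d (m≥n⇒m/n>0 d≤x)) ⟩
  x / d * d + x / d * d     ≡⟨ double (x / d) d ⟩
  d * 2 * (x / d)           ∎
  where
  open ≤-Reasoning
  double : ∀ q d → q * d + q * d ≡ d * 2 * q
  double = solve-∀

module SpaceBound (k' : ℕ) where

  k D C : ℕ
  k = suc k'
  D = 2 * k
  C = D ^ k

  instance
    C-nonZero : NonZero C
    C-nonZero = >-nonZero (m^n>0 D k)

  k≤D : k ≤ D
  k≤D = m≤n*m k 2

  few-items : ∀ {n} mb → n ≤ k → ¬ C * D ≤ mb ⊓ (n ^ k)
  few-items {n} mb n≤k CD≤ = <⇒≱ (begin-strict
    mb ⊓ (n ^ k)  ≤⟨ m⊓n≤n mb (n ^ k) ⟩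
    n ^ k         ≤⟨ ^-monoˡ-≤ k (≤-trans n≤k k≤D) ⟩
    C             <⟨ m<m*n C D (*-monoʳ-≤ 2 (s≤s z≤n)) ⟩
    C * D         ∎) CD≤
    where open ≤-Reasoning

  -- With more than k items, fool the algorithm with m = ⌊(mb ⊓ X)/D⌋ pairs of
  -- k-itemsets avoiding item 0, where X = #kItemsets n' k ≥ (n' + 1)^k / C.
  space-bound : ∀ n mb → k < n → C * D ≤ mb ⊓ (n ^ k) → (A : StreamAlg n) → Determines k A →
    ∃[ s ] (totalSize s ≡ mb × mb ⊓ (n ^ k) ≤ C * D * 2 * space A s)
  space-bound (suc n') mb (s≤s k≤n') CD≤ A determines =
    let s , size≡mb , m≤space = fooling-bound A determines P ∣P∣≡1 xs xs-unique xs-k-sets xs-avoid-P m≤#pairs mb mk≤mb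
    in  s , size≡mb , enough-space {s} m≤space
    where
    open ≤-Reasoning
    X = #kItemsets n' k
    x = mb ⊓ X
    m = x / D
    -- the padding transaction {0} and the k-itemsets over the items 1..n'
    P : Subset (suc n')
    P = inside ∷ ⊥
    ∣P∣≡1 : ∣ P ∣ ≡ 1
    ∣P∣≡1 = cong suc (∣⊥∣≡0 n')
    xs : List (Subset (suc n'))
    xs = map (outside ∷_) (kItemsets n' k)
    xs-unique : Unique xs
    xs-unique = Unique.map⁺ ∷-injectiveʳ (kItemsets-unique n' k)
    xs-k-sets : ∀ {T} → T ∈ xs → ∣ T ∣ ≡ k
    xs-k-sets T∈ with ∈-map⁻ (outside ∷_) T∈
    ... | I , I∈ , refl = kItemsets-card I∈
    xs-avoid-P : ∀ {T} → T ∈ xs → ¬ T ⊆ P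
    xs-avoid-P T∈ T⊆P with ∈-map⁻ (outside ∷_) T∈
    ... | I , I∈ , refl = contradiction
      (subst (_≤ 0) (kItemsets-card I∈) (≤-trans (p⊆q⇒∣p∣≤∣q∣ (drop-∷-⊆ T⊆P)) (≤-reflexive (∣⊥∣≡0 n')))) λ ()
    D≤mb : D ≤ mb
    D≤mb = ≤-trans (m≤n*m D C) (≤-trans CD≤ (m⊓n≤m mb _))
    D≤X : D ≤ X
    D≤X = *-cancelˡ-≤ C (≤-trans CD≤ (≤-trans (m⊓n≤n mb _) (#kItemsets-large k n' k≤n')))
    mD≤x : m * D ≤ x
    mD≤x = m/n*n≤m x D
    twice : ∀ m → m + m ≡ m * 2
    twice = solve-∀
    m≤#pairs : m ≤ #pairs xs
    m≤#pairs = #pairs-≥ xs (begin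
      m + m      ≡⟨ twice m ⟩
      m * 2      ≤⟨ *-monoʳ-≤ m (*-monoʳ-≤ 2 (s≤s z≤n)) ⟩
      m * D      ≤⟨ mD≤x ⟩
      x          ≤⟨ m⊓n≤n mb X ⟩
      X          ≡⟨ length-map (outside ∷_) (kItemsets n' k) ⟨
      length xs  ∎)
    mk≤mb : m * k ≤ mb
    mk≤mb = ≤-trans (*-monoʳ-≤ m k≤D) (≤-trans mD≤x (m⊓n≤m mb X))
    reassociate : ∀ C D m → C * (D * 2 * m) ≡ C * D * 2 * m
    reassociate = solve-∀
    enough-space : ∀ {s} → m ≤ space A s → mb ⊓ (suc n' ^ k) ≤ C * D * 2 * space A s
    enough-space {s} m≤space = begin
      mb ⊓ (suc n' ^ k)     ≤⟨ ⊓-mono-≤ (m≤n*m mb C) (#kItemsets-large k n' k≤n') ⟩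
      (C * mb) ⊓ (C * X)    ≡⟨ *-distribˡ-⊓ C mb X ⟨
      C * x                 ≤⟨ *-monoʳ-≤ C (≤-double-quotient x D (⊓-glb D≤mb D≤X)) ⟩
      C * (D * 2 * m)       ≡⟨ reassociate C D m ⟩
      C * D * 2 * m         ≤⟨ *-monoʳ-≤ (C * D * 2) m≤space ⟩
      C * D * 2 * space A s ∎

corollary1 : (k : ℕ) → 0 < k →
    ∃[ c ] ∃[ N₀ ] ((n mb : ℕ) → N₀ ≤ mb ⊓ (n ^ k) →
    (A : StreamAlg n) → Determines k A →
    ∃[ s ] (totalSize s ≡ mb × mb ⊓ (n ^ k) ≤ c * space A s))
corollary1 zero    ()
corollary1 (suc k') _ = C * D * 2 , C * D , bound
  where
  open SpaceBound k'
  bound : (n mb : ℕ) → C * D ≤ mb ⊓ (n ^ k) → (A : StreamAlg n) → Determines k A →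
    ∃[ s ] (totalSize s ≡ mb × mb ⊓ (n ^ k) ≤ C * D * 2 * space A s)
  bound n mb CD≤ A determines with k <? n
  ... | yes k<n = space-bound n mb k<n CD≤ A determines
  ... | no  k≮n = contradiction CD≤ (few-items mb (≮⇒≥ k≮n))
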